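{- A constraint language $\Gamma$ on a finite set $D$ is congruence singular if, and only if, it is strongly balanced.
   Context: A constraint language on $D$ is a finite set of finitary relations on $D$ containing equality. A relation is pp-definable over $\Gamma$ if definable from relations of $\Gamma$ by conjunction and existential quantification (variables may repeat). A congruence on a pp-definable set $A\subseteq D^r$ is a pp-definable relation $\rho\subseteq D^r\times D^r$ that is an equivalence relation on $A$. A matrix $f\colon A_1\times A_2\to\mathbb{Q}_{\ge0}$ is a rank-one block matrix if its underlying relation $B=\{(x,y):f(x,y)>0\}$ is rectangular ($(a,c),(a,d),(b,c)\in B\Rightarrow(b,d)\in B$) and each block (submatrix on a connected component of the bipartite support graph) has rank one. $\Gamma$ is congruence singular if for every pp-definable $A\subseteq D^r$ and every pair of congruences $\rho_1,\rho_2$ on $A$, with equivalence classes $E_{1j}$ ($j\in[\nu_1]$) and $E_{2k}$ ($k\in[\nu_2]$) respectively, the matrix $\mathcal{M}(j,k)=|E_{1j}\cap E_{2k}|$ is a rank-one block matrix. $R\subseteq D^n$, $n\ge3$, is balanced if for all $k,\ell\ge1$ with $k+\ell<n$ the matrix $M(x,y)=|\{z\in D^{n-k-\ell}:(x,y,z)\in R\}|$ ($x\in D^k,y\in D^\ell$) is a rank-one block matrix; $\Gamma$ is strongly balanced if every pp-definable relation of arity $\ge3$ is balanced. -}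

module Defs where

open import Data.Nat using (ℕ; zero; suc; _+_; _∸_; _≤_; _<_)
open import Data.Nat.Properties using (m+[n∸m]≡n; <⇒≤)
open import Data.Fin using (Fin; _≟_)
open import Data.Vec using (Vec; []; _∷_; _++_; cast; tabulate; lookup)
open import Data.List using (List; []; _∷_; map; concatMap)
open import Data.Nat.ListAction using (sum)
open import Data.List.Relation.Unary.All using (All)
open import Data.Bool using (Bool; true; false; _∧_; if_then_else_)
open import Data.Product using (Σ; ∃; ∃-syntax; _×_; _,_)
open import Data.Sum using (_⊎_; inj₁; inj₂)
open import Data.Empty using (⊥)
open import Data.Integer using (+_)
open import Data.Rational using (ℚ; _/_; _*_)
open import Relation.Nullary.Decidable using (⌊_⌋)
open import Relation.Binary.PropositionalEquality using (_≡_)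
open import Relation.Binary.Construct.Closure.ReflexiveTransitive using (Star)
open import Function.Bundles using (_⇔_)

toℚ : ℕ → ℚ
toℚ n = (+ n) / 1

Rectangular : {I J : Set} → (I → J → ℕ) → Set
Rectangular {I} {J} f =
  ∀ (a b : I) (c e : J) → 0 < f a c → 0 < f a e → 0 < f b c → 0 < f b e

SuppAdj : {I J : Set} → (I → J → ℕ) → I ⊎ J → I ⊎ J → Set
SuppAdj f (inj₁ a) (inj₂ c) = 0 < f a c
SuppAdj f (inj₂ c) (inj₁ a) = 0 < f a c
SuppAdj f (inj₁ _) (inj₁ _) = ⊥
SuppAdj f (inj₂ _) (inj₂ _) = ⊥

Connected : {I J : Set} → (I → J → ℕ) → I ⊎ J → I ⊎ J → Set
Connected f = Star (SuppAdj f)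

-- every block (submatrix on a connected component of the support graph
-- containing an edge (a₀,c₀)) has rank one: it is an outer product u vᵀ
-- (it is nonzero since f a₀ c₀ > 0)
BlocksRankOne : {I J : Set} → (I → J → ℕ) → Set
BlocksRankOne {I} {J} f =
  ∀ (a₀ : I) (c₀ : J) → 0 < f a₀ c₀ →
  Σ (I → ℚ) λ u → Σ (J → ℚ) λ v →
    ∀ (a : I) (c : J) →
      Connected f (inj₁ a₀) (inj₁ a) → Connected f (inj₁ a₀) (inj₂ c) →
      toℚ (f a c) ≡ u a * v c

RankOneBlock : {I J : Set} → (I → J → ℕ) → Set
RankOneBlock f = Rectangular f × BlocksRankOne f

Rel : ℕ → ℕ → Set
Rel d r = Vec (Fin d) r → Bool

_∈R_ : ∀ {d r} → Vec (Fin d) r → Rel d r → Set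
x ∈R R = R x ≡ true

allVecs : (d m : ℕ) → List (Vec (Fin d) m)
allVecs d zero = [] ∷ []
allVecs d (suc m) =
  concatMap (λ v → map (_∷ v) (Data.List.Base.tabulate {n = d} (λ i → i))) (allVecs d m)
  where import Data.List.Base

count : ∀ {d} (m : ℕ) → (Vec (Fin d) m → Bool) → ℕ
count {d} m P = sum (map (λ v → if P v then 1 else 0) (allVecs d m))

IsEqRel : ∀ {d} (k : ℕ) → Rel d k → Set
IsEqRel {d} 2 R = ∀ (a b : Fin d) → R (a ∷ b ∷ []) ≡ ⌊ a ≟ b ⌋
IsEqRel {d} _ R = ⊥

record Lang (d : ℕ) : Set where
  field
    size  : ℕ
    arity : Fin size → ℕ
    rel   : (i : Fin size) → Rel d (arity i)
    hasEq : ∃[ i ] IsEqRel (arity i) (rel i)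
open Lang public

Atom : ∀ {d} → Lang d → ℕ → Set
Atom Γ n = Σ (Fin (size Γ)) λ i → (Fin (arity Γ i) → Fin n)

AtomHolds : ∀ {d} (Γ : Lang d) {n} → Vec (Fin d) n → Atom Γ n → Set
AtomHolds Γ w (i , σ) = rel Γ i (tabulate (λ p → lookup w (σ p))) ≡ true

PPDef : ∀ {d} (Γ : Lang d) {r : ℕ} → Rel d r → Set
PPDef {d} Γ {r} R =
  Σ ℕ λ m → Σ (List (Atom Γ (r + m))) λ atoms →
    ∀ (x : Vec (Fin d) r) →
      (x ∈R R) ⇔ (Σ (Vec (Fin d) m) λ y → All (AtomHolds Γ (x ++ y)) atoms)

-- ρ ⊆ D^r × D^r (encoded as a relation of arity r + r on (a ++ b))
-- is a pp-definable equivalence relation on A (in particular ρ ⊆ A × A)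
Congruence : ∀ {d} (Γ : Lang d) {r} → Rel d r → Rel d (r + r) → Set
Congruence {d} Γ {r} A ρ =
  PPDef Γ ρ ×
  (∀ (a b : Vec (Fin d) r) → (a ++ b) ∈R ρ → (a ∈R A) × (b ∈R A)) ×
  (∀ (a : Vec (Fin d) r) → a ∈R A → (a ++ a) ∈R ρ) ×
  (∀ (a b : Vec (Fin d) r) → (a ++ b) ∈R ρ → (b ++ a) ∈R ρ) ×
  (∀ (a b c : Vec (Fin d) r) → (a ++ b) ∈R ρ → (b ++ c) ∈R ρ → (a ++ c) ∈R ρ)

-- an enumeration E_1,...,E_ν (indexed by Fin ν) of the equivalence classes
-- of ρ on A, given by the map sending a ∈ A to the index of its class:
-- every index is used, and a, b ∈ A lie in the same class iff ρ(a,b)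
ClassEnumeration : ∀ {d r} → Rel d r → Rel d (r + r) →
                   (ν : ℕ) → (Vec (Fin d) r → Fin ν) → Set
ClassEnumeration {d} {r} A ρ ν cls =
  (∀ (j : Fin ν) → Σ (Vec (Fin d) r) λ a → (a ∈R A) × (cls a ≡ j)) ×
  (∀ (a b : Vec (Fin d) r) → a ∈R A → b ∈R A → ((a ++ b) ∈R ρ) ⇔ (cls a ≡ cls b))

classMatrix : ∀ {d} (r : ℕ) → Rel d r →
              {ν₁ ν₂ : ℕ} → (Vec (Fin d) r → Fin ν₁) → (Vec (Fin d) r → Fin ν₂) →
              Fin ν₁ → Fin ν₂ → ℕ
classMatrix r A c₁ c₂ j k =
  count r (λ a → A a ∧ (⌊ c₁ a ≟ j ⌋ ∧ ⌊ c₂ a ≟ k ⌋))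

CongruenceSingular : ∀ {d} → Lang d → Set
CongruenceSingular {d} Γ =
  ∀ (r : ℕ) (A : Rel d r) → PPDef Γ A →
  ∀ (ρ₁ ρ₂ : Rel d (r + r)) → Congruence Γ A ρ₁ → Congruence Γ A ρ₂ →
  ∀ (ν₁ : ℕ) (c₁ : Vec (Fin d) r → Fin ν₁) (ν₂ : ℕ) (c₂ : Vec (Fin d) r → Fin ν₂) →
  ClassEnumeration A ρ₁ ν₁ c₁ → ClassEnumeration A ρ₂ ν₂ c₂ →
  RankOneBlock (classMatrix r A c₁ c₂)

balMatrix : ∀ {d n} (R : Rel d n) (k ℓ : ℕ) → k + ℓ < n →
            Vec (Fin d) k → Vec (Fin d) ℓ → ℕ
balMatrix {d} {n} R k ℓ h x y =
  count (n ∸ (k + ℓ)) (λ z → R (cast (m+[n∸m]≡n (<⇒≤ h)) ((x ++ y) ++ z)))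

Balanced : ∀ {d n} → Rel d n → Set
Balanced {d} {n} R =
  ∀ (k ℓ : ℕ) → 1 ≤ k → 1 ≤ ℓ → (h : k + ℓ < n) → RankOneBlock (balMatrix R k ℓ h)

StronglyBalanced : ∀ {d} → Lang d → Set
StronglyBalanced {d} Γ = ∀ (n : ℕ) (R : Rel d n) → 3 ≤ n → PPDef Γ R → Balanced R

module Submission where

-- Both directions compare class matrices with balance matrices, and the rank-one block property
-- passes between them because it is preserved by reindexing rows and columns, as long as the
-- entries that are not reached by the reindexing vanish.
--
-- (⇐) Let ρ₁, ρ₂ be congruences on A ⊆ Dʳ with class representatives a_j and b_k. The relation
-- R(x, y, z) = ρ₁(x, z) ∧ ρ₂(y, z) is pp-definable of arity 3r, and its balance matrix at
-- (a_j, b_k) counts the z in E_{1j} ∩ E_{2k}. (For r = 0 the class matrix has a single nonzero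
-- entry.)
--
-- (⇒) Write R ⊆ D^{k + ℓ + m} as a set of triples (x, y, z). The kernels of the projections of R
-- onto x and onto y are pp-definable congruences on R, whose classes are indexed by the projected
-- tuples. The intersection of the classes of x and y is {(x, y, z) ∈ R}, so the class matrix is the
-- balance matrix restricted to the projections of R; outside them the balance matrix vanishes.

open import Defs
open import Data.Bool using (Bool; true; false; _∧_; if_then_else_)
import Data.Bool as Bool
open import Data.Bool.Properties using (⇔→≡; ∧-identityʳ)
open import Data.Empty using (⊥-elim)
open import Data.Fin using (Fin; zero; suc; _↑ˡ_; _↑ʳ_; splitAt)
import Data.Fin as Fin
open import Data.Fin.Properties using (suc-injective)
open import Data.List using (List; []; _∷_; map; concatMap; filter; deduplicate)
import Data.List as List
open import Data.List.Membership.Propositional using (_∈_)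
open import Data.List.Membership.Propositional.Properties
  using ( ∈-lookup; ∈-map⁺; ∈-tabulate⁺; ∈-concat⁺′; ∈-map∘filter⁺; ∈-map∘filter⁻
        ; ∈-deduplicate⁺; ∈-deduplicate⁻)
open import Data.List.Properties using (map-cong; map-∘; map-++; map-tabulate)
open import Data.List.Relation.Unary.All using (All)
import Data.List.Relation.Unary.All as All
import Data.List.Relation.Unary.All.Properties as All
open import Data.List.Relation.Unary.AllPairs using (_∷_)
open import Data.List.Relation.Unary.Any using (here; index)
open import Data.List.Relation.Unary.Any.Properties using (lookup-index)
open import Data.List.Relation.Unary.Unique.Propositional using (Unique)
open import Data.List.Relation.Unary.Unique.DecPropositional.Properties using (deduplicate-!)
open import Data.Nat using (ℕ; zero; suc; _+_; _∸_; _≤_; _<_; z≤n; s≤s)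
open import Data.Nat.ListAction using (sum)
open import Data.Nat.ListAction.Properties using (sum-++)
open import Data.Nat.Properties using (+-identityʳ; m+n∸m≡n; m+[n∸m]≡n; <⇒≤; +-mono-≤; m<m+n)
open import Data.Product using (Σ; ∃; _×_; _,_; proj₁; proj₂)
import Data.Product as Product
open import Data.Product.Function.Dependent.Propositional using () renaming (cong to Σ-cong)
open import Data.Product.Function.NonDependent.Propositional using (_×-cong_)
open import Data.Rational using (1ℚ)
open import Data.Rational.Properties using (*-identityʳ)
open import Data.Sum using (_⊎_; [_,_]′; inj₁; inj₂)
import Data.Sum as Sum
open import Data.Unit using (⊤; tt)
open import Data.Vec using (Vec; []; _∷_; _++_; cast; tabulate; lookup)
import Data.Vec as Vec
open import Data.Vec.Properties
  using ( tabulate-cong; tabulate∘lookup; lookup∘tabulate; lookup-++ˡ; lookup-++ʳ; lookup-splitAt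
        ; ∷-injectiveˡ; ∷-injectiveʳ; ++-injectiveˡ; ++-injectiveʳ; cast-is-id; ≡-dec)
open import Function using (_∘_; id)
open import Function.Bundles using (_⇔_; mk⇔; Equivalence)
open import Function.Construct.Composition using (_⇔-∘_)
open import Function.Construct.Identity using (↔-id; ⇔-id)
open import Function.Construct.Symmetry using (⇔-sym)
open import Function.Properties.Equivalence using (⇔-setoid)
open import Level using (0ℓ)
open import Relation.Binary.Construct.Closure.ReflexiveTransitive using (ε; _◅_; gmap)
open import Relation.Binary.Definitions using (DecidableEquality)
open import Relation.Binary.PropositionalEquality
import Relation.Binary.Reasoning.Setoid as SetoidReasoning
open import Relation.Nullary using (Dec; yes; no; ¬_)
open import Relation.Nullary.Decidable using (⌊_⌋)

open Equivalence using (to; from)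
module ⇔-Reasoning = SetoidReasoning (⇔-setoid 0ℓ)

private
  variable
    X : Set
    a b k m n : ℕ

∧-≡-true : ∀ {x y} → (x ∧ y ≡ true) ⇔ (x ≡ true × y ≡ true)
∧-≡-true {true}  {true}  = mk⇔ (λ _ → refl , refl) (λ _ → refl)
∧-≡-true {true}  {false} = mk⇔ (λ ()) (λ ())
∧-≡-true {false}         = mk⇔ (λ ()) (λ ())

⌊⌋-≡-true : ∀ {P : Set} (P? : Dec P) → (⌊ P? ⌋ ≡ true) ⇔ P
⌊⌋-≡-true (yes p) = mk⇔ (λ _ → p) (λ _ → refl)
⌊⌋-≡-true (no ¬p) = mk⇔ (λ ()) (⊥-elim ∘ ¬p)

select : (Fin k → Fin n) → Vec X n → Vec X k
select σ w = tabulate (lookup w ∘ σ)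

_⊕_ : (Fin a → Fin n) → (Fin b → Fin n) → Fin (a + b) → Fin n
_⊕_ {a} σ τ = [ σ , τ ]′ ∘ splitAt a

select-id : (w : Vec X n) → select id w ≡ w
select-id = tabulate∘lookup

select-∘ : (τ : Fin n → Fin m) (σ : Fin k → Fin n) (w : Vec X m) →
           select (τ ∘ σ) w ≡ select σ (select τ w)
select-∘ τ σ w = tabulate-cong (λ p → sym (lookup∘tabulate (lookup w ∘ τ) (σ p)))

select-++ˡ : (σ : Fin k → Fin m) (u : Vec X m) (v : Vec X n) → select ((_↑ˡ n) ∘ σ) (u ++ v) ≡ select σ u
select-++ˡ σ u v = tabulate-cong (λ p → lookup-++ˡ u v (σ p))

select-++ʳ : (σ : Fin k → Fin n) (u : Vec X m) (v : Vec X n) → select ((m ↑ʳ_) ∘ σ) (u ++ v) ≡ select σ v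
select-++ʳ σ u v = tabulate-cong (λ p → lookup-++ʳ u v (σ p))

select-↑ˡ : (u : Vec X m) (v : Vec X n) → select (_↑ˡ n) (u ++ v) ≡ u
select-↑ˡ u v = trans (select-++ˡ id u v) (select-id u)

select-↑ʳ : (u : Vec X m) (v : Vec X n) → select (m ↑ʳ_) (u ++ v) ≡ v
select-↑ʳ u v = trans (select-++ʳ id u v) (select-id v)

select-⊕ : (σ : Fin a → Fin n) (τ : Fin b → Fin n) (w : Vec X n) →
           select (σ ⊕ τ) w ≡ select σ w ++ select τ w
select-⊕ {a} σ τ w = trans (tabulate-cong coordinate) (tabulate∘lookup (select σ w ++ select τ w))
  where
  pieces : ∀ s → lookup w ([ σ , τ ]′ s) ≡ [ lookup (select σ w) , lookup (select τ w) ]′ s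
  pieces (inj₁ i) = sym (lookup∘tabulate (lookup w ∘ σ) i)
  pieces (inj₂ j) = sym (lookup∘tabulate (lookup w ∘ τ) j)
  coordinate : ∀ q → lookup w ((σ ⊕ τ) q) ≡ lookup (select σ w ++ select τ w) q
  coordinate q = trans (pieces (splitAt a q)) (sym (lookup-splitAt a (select σ w) (select τ w) q))

select-⊕-++ : (σ : Fin a → Fin m) (τ : Fin b → Fin n) (u : Vec X m) (v : Vec X n) →
              select (((_↑ˡ n) ∘ σ) ⊕ ((m ↑ʳ_) ∘ τ)) (u ++ v) ≡ select σ u ++ select τ v
select-⊕-++ {m = m} {n = n} σ τ u v =
  trans (select-⊕ ((_↑ˡ n) ∘ σ) ((m ↑ʳ_) ∘ τ) (u ++ v)) (cong₂ _++_ (select-++ˡ σ u v) (select-++ʳ τ u v))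

select-halves⇔ : (w : Vec X (m + n)) (u : Vec X m) (v : Vec X n) →
                 (select (_↑ˡ n) w ≡ u × select (m ↑ʳ_) w ≡ v) ⇔ w ≡ u ++ v
select-halves⇔ {m = m} w u v with w₁ , w₂ , refl ← Vec.splitAt m w = mk⇔
  (λ (e₁ , e₂) → cong₂ _++_ (trans (sym (select-↑ˡ w₁ w₂)) e₁) (trans (sym (select-↑ʳ w₁ w₂)) e₂))
  (λ e → trans (select-↑ˡ w₁ w₂) (++-injectiveˡ w₁ u e) , trans (select-↑ʳ w₁ w₂) (++-injectiveʳ w₁ u e))

select-≡⇔ : (σ τ : Fin k → Fin n) (w : Vec X n) →
            select σ w ≡ select τ w ⇔ (∀ p → lookup w (σ p) ≡ lookup w (τ p))
select-≡⇔ σ τ w = mk⇔ coordinates tabulate-cong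
  where
  coordinates : select σ w ≡ select τ w → ∀ p → lookup w (σ p) ≡ lookup w (τ p)
  coordinates e p = begin
    lookup w (σ p)        ≡⟨ lookup∘tabulate (lookup w ∘ σ) p ⟨
    lookup (select σ w) p ≡⟨ cong (λ v → lookup v p) e ⟩
    lookup (select τ w) p ≡⟨ lookup∘tabulate (lookup w ∘ τ) p ⟩
    lookup w (τ p)        ∎
    where open ≡-Reasoning

module _ {d : ℕ} where

  private
    indicator : Bool → ℕ
    indicator b = if b then 1 else 0

    sum-map-concatMap : {B C : Set} (f : C → ℕ) (g : B → List C) (xs : List B) →
                        sum (map f (concatMap g xs)) ≡ sum (map (sum ∘ map f ∘ g) xs)
    sum-map-concatMap f g []       = refl
    sum-map-concatMap f g (x ∷ xs) = begin
      sum (map f (g x List.++ concatMap g xs))         ≡⟨ cong sum (map-++ f (g x) (concatMap g xs)) ⟩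
      sum (map f (g x) List.++ map f (concatMap g xs)) ≡⟨ sum-++ (map f (g x)) (map f (concatMap g xs)) ⟩
      sum (map f (g x)) + sum (map f (concatMap g xs)) ≡⟨ cong (sum (map f (g x)) +_) (sum-map-concatMap f g xs) ⟩
      sum (map (sum ∘ map f ∘ g) (x ∷ xs))             ∎
      where open ≡-Reasoning

    sum-tabulate-zero : (f : Fin n → ℕ) → (∀ i → f i ≡ 0) → sum (List.tabulate f) ≡ 0
    sum-tabulate-zero {zero}  f f≡0 = refl
    sum-tabulate-zero {suc n} f f≡0 = cong₂ _+_ (f≡0 zero) (sum-tabulate-zero (f ∘ suc) (f≡0 ∘ suc))

    sum-tabulate-single : (f : Fin n → ℕ) (i₀ : Fin n) → (∀ i → ¬ i ≡ i₀ → f i ≡ 0) →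
                          sum (List.tabulate f) ≡ f i₀
    sum-tabulate-single f zero others =
      trans (cong (f zero +_) (sum-tabulate-zero (f ∘ suc) (λ i → others (suc i) (λ ())))) (+-identityʳ (f zero))
    sum-tabulate-single f (suc i₀) others =
      cong₂ _+_ (others zero (λ ()))
                (sum-tabulate-single (f ∘ suc) i₀ (λ i i≢i₀ → others (suc i) (i≢i₀ ∘ suc-injective)))

  count-cong : {P Q : Vec (Fin d) m → Bool} → (∀ v → P v ≡ Q v) → count m P ≡ count m Q
  count-cong {m} P≗Q = cong sum (map-cong (cong indicator ∘ P≗Q) (allVecs d m))

  count-witness : {P : Vec (Fin d) m → Bool} → 0 < count m P → ∃ λ v → P v ≡ true
  count-witness {m} {P} = search (allVecs d m)
    where
    search : ∀ vs → 0 < sum (map (indicator ∘ P) vs) → ∃ λ v → P v ≡ true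
    search (v ∷ vs) pos with P v in Pv
    ... | true  = v , Pv
    ... | false = search vs pos

  count-cons : (P : Vec (Fin d) (suc m) → Bool) (i₀ : Fin d) → (∀ i v → P (i ∷ v) ≡ true → i ≡ i₀) →
               count (suc m) P ≡ count m (λ v → P (i₀ ∷ v))
  count-cons {m} P i₀ forced =
    trans (sum-map-concatMap _ _ (allVecs d m)) (cong sum (map-cong column (allVecs d m)))
    where
    heads : List (Fin d)
    heads = List.tabulate id
    column : ∀ v → sum (map (indicator ∘ P) (map (_∷ v) heads)) ≡ indicator (P (i₀ ∷ v))
    column v = begin
      sum (map (indicator ∘ P) (map (_∷ v) heads))      ≡⟨ cong sum (map-∘ {g = indicator ∘ P} heads) ⟨
      sum (map (indicator ∘ P ∘ (_∷ v)) heads)          ≡⟨ cong sum (map-tabulate id (indicator ∘ P ∘ (_∷ v))) ⟩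
      sum (List.tabulate (λ i → indicator (P (i ∷ v)))) ≡⟨ sum-tabulate-single _ i₀ vanish ⟩
      indicator (P (i₀ ∷ v))                            ∎
      where
      open ≡-Reasoning
      vanish : ∀ i → ¬ i ≡ i₀ → indicator (P (i ∷ v)) ≡ 0
      vanish i i≢i₀ with P (i ∷ v) in Piv
      ... | true  = ⊥-elim (i≢i₀ (forced i v Piv))
      ... | false = refl

  count-++ : (u₀ : Vec (Fin d) a) (P : Vec (Fin d) (a + m) → Bool) → (∀ u z → P (u ++ z) ≡ true → u ≡ u₀) →
             count (a + m) P ≡ count m (λ z → P (u₀ ++ z))
  count-++ []                P forced = refl
  count-++ {suc a} (i₀ ∷ u₀) P forced =
    trans (count-cons P i₀ head-forced)
          (count-++ u₀ (λ w → P (i₀ ∷ w)) (λ u z → ∷-injectiveʳ ∘ forced (i₀ ∷ u) z))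
    where
    head-forced : ∀ i w → P (i ∷ w) ≡ true → i ≡ i₀
    head-forced i w Piw with u , z , refl ← Vec.splitAt a w = ∷-injectiveˡ (forced (i ∷ u) z Piw)

  balMatrix-++ : ∀ {k ℓ m} (R : Rel d ((k + ℓ) + m)) (short : k + ℓ < (k + ℓ) + m) x y →
                 balMatrix R k ℓ short x y ≡ count m (λ z → R ((x ++ y) ++ z))
  balMatrix-++ {k} {ℓ} {m} R short x y = uncast (m+n∸m≡n (k + ℓ) m) (m+[n∸m]≡n (<⇒≤ short))
    where
    uncast : ∀ {j} → j ≡ m → (e : (k + ℓ) + j ≡ (k + ℓ) + m) →
             count j (λ z → R (cast e ((x ++ y) ++ z))) ≡ count m (λ z → R ((x ++ y) ++ z))
    uncast refl e = count-cong (λ z → cong R (cast-is-id e ((x ++ y) ++ z)))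

module _ {I J : Set} where

  RankOneBlock-fromPositive : (f : I → J → ℕ) → (∀ a c → 0 < f a c → RankOneBlock f) → RankOneBlock f
  RankOneBlock-fromPositive f rankOne =
    (λ a b c e fac → proj₁ (rankOne a c fac) a b c e fac) , (λ a c fac → proj₂ (rankOne a c fac) a c fac)

  RankOneBlock-const : (n : ℕ) → RankOneBlock (λ (_ : I) (_ : J) → n)
  RankOneBlock-const n =
    (λ _ _ _ _ pos _ _ → pos) , (λ _ _ _ → (λ _ → toℚ n) , (λ _ → 1ℚ) , λ _ _ _ _ → sym (*-identityʳ (toℚ n)))

  Connected-invariant : (f : I → J → ℕ) (G : I ⊎ J → Set) → (∀ a c → 0 < f a c → G (inj₁ a) × G (inj₂ c)) →
                        ∀ {s t} → G s → Connected f s t → G t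
  Connected-invariant f G closed Gs ε = Gs
  Connected-invariant f G closed {inj₁ a} _ (_◅_ {j = inj₂ c} fac path) =
    Connected-invariant f G closed (proj₂ (closed a c fac)) path
  Connected-invariant f G closed {inj₂ c} _ (_◅_ {j = inj₁ a} fac path) =
    Connected-invariant f G closed (proj₁ (closed a c fac)) path

Connected-map : {I J I′ J′ : Set} (g : I′ → J′ → ℕ) (f : I → J → ℕ) (α : I′ → I) (β : J′ → J) →
                (∀ a c → 0 < g a c → 0 < f (α a) (β c)) →
                ∀ {s t} → Connected g s t → Connected f (Sum.map α β s) (Sum.map α β t)
Connected-map g f α β edge = gmap (Sum.map α β) step
  where
  step : ∀ {s t} → SuppAdj g s t → SuppAdj f (Sum.map α β s) (Sum.map α β t)
  step {inj₁ a} {inj₂ c} gac = edge a c gac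
  step {inj₂ c} {inj₁ a} gac = edge a c gac

RankOneBlock-reindex : {I J I′ J′ : Set} (f : I → J → ℕ) (g : I′ → J′ → ℕ) (α : I′ → I) (β : J′ → J)
                       (S : I′ → Set) (T : J′ → Set) →
                       (∀ a c → 0 < g a c → S a × T c) →
                       (∀ a c → S a → T c → g a c ≡ f (α a) (β c)) →
                       RankOneBlock f → RankOneBlock g
RankOneBlock-reindex f g α β S T support agree (rect , blocks) = rect′ , blocks′
  where
  edge : ∀ a c → 0 < g a c → 0 < f (α a) (β c)
  edge a c gac = subst (0 <_) (agree a c (proj₁ (support a c gac)) (proj₂ (support a c gac))) gac
  rect′ : Rectangular g
  rect′ a b c e gac gae gbc =
    subst (0 <_) (sym (agree b e (proj₁ (support b c gbc)) (proj₂ (support a e gae))))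
      (rect (α a) (α b) (β c) (β e) (edge a c gac) (edge a e gae) (edge b c gbc))
  blocks′ : BlocksRankOne g
  blocks′ a₀ c₀ ga₀c₀ with u , v , rankOne ← blocks (α a₀) (β c₀) (edge a₀ c₀ ga₀c₀) =
    u ∘ α , v ∘ β , λ a c a₀~a a₀~c →
      trans (cong toℚ (agree a c (reach a₀~a) (reach a₀~c)))
            (rankOne (α a) (β c) (Connected-map g f α β edge a₀~a) (Connected-map g f α β edge a₀~c))
    where
    reach : ∀ {t} → Connected g (inj₁ a₀) t → [ S , T ]′ t
    reach = Connected-invariant g [ S , T ]′ support (proj₁ (support a₀ c₀ ga₀c₀))

infix 4 _≟ᵛ_
_≟ᵛ_ : ∀ {d n} → DecidableEquality (Vec (Fin d) n)
_≟ᵛ_ = ≡-dec Fin._≟_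

Agree : ∀ {d} → (Fin k → Fin n) → (Fin k → Fin n) → Rel d n
Agree σ τ x = ⌊ select σ x ≟ᵛ select τ x ⌋

module PP {d : ℕ} (Γ : Lang d) where

  renameAtom : (Fin n → Fin m) → Atom Γ n → Atom Γ m
  renameAtom ρ (i , σ) = i , ρ ∘ σ

  All-renameAtom : (ρ : Fin n → Fin m) (w : Vec (Fin d) m) {w′ : Vec (Fin d) n} → select ρ w ≡ w′ →
                   (ats : List (Atom Γ n)) →
                   All (AtomHolds Γ w) (map (renameAtom ρ) ats) ⇔ All (AtomHolds Γ w′) ats
  All-renameAtom ρ w {w′} ρw≡w′ ats =
    mk⇔ (All.map (subst id (holds _)) ∘ All.map⁻) (All.map⁺ ∘ All.map (subst id (sym (holds _))))
    where
    holds : ∀ at → AtomHolds Γ w (renameAtom ρ at) ≡ AtomHolds Γ w′ at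
    holds (i , σ) = cong (λ v → rel Γ i v ≡ true) (trans (select-∘ ρ σ w) (cong (select σ) ρw≡w′))

  Satisfies : List (Atom Γ (n + m)) → Vec (Fin d) n → Set
  Satisfies {m = m} ats x = Σ (Vec (Fin d) m) λ y → All (AtomHolds Γ (x ++ y)) ats

  castPP : (e : m ≡ n) {R : Rel d n} → PPDef Γ R → PPDef Γ (λ x → R (cast e x))
  castPP refl {R} (m , ats , defn) = m , ats , λ x →
    defn x ⇔-∘ mk⇔ (trans (cong R (sym (cast-is-id refl x)))) (trans (cong R (cast-is-id refl x)))

  reindexPP : (τ : Fin k → Fin n) {S : Rel d k} → PPDef Γ S → PPDef Γ (λ x → S (select τ x))
  reindexPP {k = k} {n = n} τ (m , ats , defn) = m , map (renameAtom ρ) ats , λ x →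
    ⇔-sym (Σ-cong (↔-id _) (λ {y} → All-renameAtom ρ (x ++ y) (relocate x y) ats)) ⇔-∘ defn (select τ x)
    where
    ρ : Fin (k + m) → Fin (n + m)
    ρ = ((_↑ˡ m) ∘ τ) ⊕ ((n ↑ʳ_) ∘ id)
    relocate : ∀ x y → select ρ (x ++ y) ≡ select τ x ++ y
    relocate x y = trans (select-⊕-++ τ id x y) (cong (select τ x ++_) (select-id y))

  conjPP : {S₁ S₂ : Rel d n} → PPDef Γ S₁ → PPDef Γ S₂ → PPDef Γ (λ x → S₁ x ∧ S₂ x)
  conjPP {n = n} (m₁ , ats₁ , defn₁) (m₂ , ats₂ , defn₂) = m₁ + m₂ , ats , λ x →
    satisfiesBoth x ⇔-∘ ((defn₁ x ×-cong defn₂ x) ⇔-∘ ∧-≡-true)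
    where
    ρ₁ : Fin (n + m₁) → Fin (n + (m₁ + m₂))
    ρ₁ = ((_↑ˡ (m₁ + m₂)) ∘ id) ⊕ ((n ↑ʳ_) ∘ (_↑ˡ m₂))
    ρ₂ : Fin (n + m₂) → Fin (n + (m₁ + m₂))
    ρ₂ = ((_↑ˡ (m₁ + m₂)) ∘ id) ⊕ ((n ↑ʳ_) ∘ (m₁ ↑ʳ_))
    ats : List (Atom Γ (n + (m₁ + m₂)))
    ats = map (renameAtom ρ₁) ats₁ List.++ map (renameAtom ρ₂) ats₂
    module _ (x : Vec (Fin d) n) (y₁ : Vec (Fin d) m₁) (y₂ : Vec (Fin d) m₂) where
      first : All (AtomHolds Γ (x ++ (y₁ ++ y₂))) (map (renameAtom ρ₁) ats₁) ⇔ All (AtomHolds Γ (x ++ y₁)) ats₁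
      first = All-renameAtom ρ₁ (x ++ (y₁ ++ y₂))
        (trans (select-⊕-++ id (_↑ˡ m₂) x (y₁ ++ y₂)) (cong₂ _++_ (select-id x) (select-↑ˡ y₁ y₂))) ats₁
      second : All (AtomHolds Γ (x ++ (y₁ ++ y₂))) (map (renameAtom ρ₂) ats₂) ⇔ All (AtomHolds Γ (x ++ y₂)) ats₂
      second = All-renameAtom ρ₂ (x ++ (y₁ ++ y₂))
        (trans (select-⊕-++ id (m₁ ↑ʳ_) x (y₁ ++ y₂)) (cong₂ _++_ (select-id x) (select-↑ʳ y₁ y₂))) ats₂
    satisfiesBoth : ∀ x → (Satisfies ats₁ x × Satisfies ats₂ x) ⇔ Satisfies ats x
    satisfiesBoth x = mk⇔ join split
      where
      join : Satisfies ats₁ x × Satisfies ats₂ x → Satisfies ats x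
      join ((y₁ , sat₁) , (y₂ , sat₂)) =
        y₁ ++ y₂ , All.++⁺ (from (first x y₁ y₂) sat₁) (from (second x y₁ y₂) sat₂)
      split : Satisfies ats x → Satisfies ats₁ x × Satisfies ats₂ x
      split (y , sat) with y₁ , y₂ , refl ← Vec.splitAt m₁ y =
        (y₁ , to (first x y₁ y₂) (All.++⁻ˡ _ sat)) , (y₂ , to (second x y₁ y₂) (All.++⁻ʳ _ sat))

  atomsPP : {S : Rel d n} (ats : List (Atom Γ n)) → (∀ x → x ∈R S ⇔ All (AtomHolds Γ x) ats) → PPDef Γ S
  atomsPP ats defn = 0 , map (renameAtom (_↑ˡ 0)) ats , λ x → withoutWitness x ⇔-∘ defn x
    where
    withoutWitness : ∀ x → All (AtomHolds Γ x) ats ⇔ Satisfies (map (renameAtom (_↑ˡ 0)) ats) x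
    withoutWitness x = mk⇔ (λ sat → [] , from renamed sat) (λ { ([] , sat) → to renamed sat })
      where
      renamed : All (AtomHolds Γ (x ++ [])) (map (renameAtom (_↑ˡ 0)) ats) ⇔ All (AtomHolds Γ x) ats
      renamed = All-renameAtom (_↑ˡ 0) (x ++ []) (select-↑ˡ x []) ats

  private
    -- IsEqRel k R is empty unless k = 2.
    pairing : {R : Rel d k} → IsEqRel k R → Fin n → Fin n → Fin k → Fin n
    pairing {k = 2} _ p q zero       = p
    pairing {k = 2} _ p q (suc zero) = q

    pairing-holds : {R : Rel d k} (isEq : IsEqRel k R) (p q : Fin n) (w : Vec (Fin d) n) →
                    (R (select (pairing isEq p q) w) ≡ true) ⇔ (lookup w p ≡ lookup w q)
    pairing-holds {k = 2} isEq p q w =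
      ⌊⌋-≡-true (lookup w p Fin.≟ lookup w q) ⇔-∘ mk⇔ (trans (sym (isEq _ _))) (trans (isEq _ _))

  equalityAtom : Fin n → Fin n → Atom Γ n
  equalityAtom p q = proj₁ (hasEq Γ) , pairing (proj₂ (hasEq Γ)) p q

  equalityAtom-holds : (p q : Fin n) (w : Vec (Fin d) n) →
                       AtomHolds Γ w (equalityAtom p q) ⇔ (lookup w p ≡ lookup w q)
  equalityAtom-holds = pairing-holds (proj₂ (hasEq Γ))

  agreePP : (σ τ : Fin k → Fin n) → PPDef Γ (Agree σ τ)
  agreePP σ τ = atomsPP (List.tabulate (λ p → equalityAtom (σ p) (τ p))) λ x →
    mk⇔ (λ eqs → All.tabulate⁺ (λ p → from (equalityAtom-holds (σ p) (τ p) x) (eqs p)))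
        (λ sat p → to (equalityAtom-holds (σ p) (τ p) x) (All.tabulate⁻ sat p))
      ⇔-∘ (select-≡⇔ σ τ x ⇔-∘ ⌊⌋-≡-true (select σ x ≟ᵛ select τ x))

kernel : ∀ {d} → Rel d n → (Fin k → Fin n) → Rel d (n + n)
kernel {n} A σ w = A (select (_↑ˡ n) w) ∧ (A (select (n ↑ʳ_) w) ∧ Agree ((_↑ˡ n) ∘ σ) ((n ↑ʳ_) ∘ σ) w)

kernel-++ : ∀ {d} (A : Rel d n) (σ : Fin k → Fin n) (a b : Vec (Fin d) n) →
            (a ++ b) ∈R kernel A σ ⇔ (a ∈R A × b ∈R A × select σ a ≡ select σ b)
kernel-++ A σ a b = begin
  (a ++ b) ∈R kernel A σ                                  ≈⟨ mk⇔ (trans (sym unfolded)) (trans unfolded) ⟩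
  A a ∧ (A b ∧ ⌊ select σ a ≟ᵛ select σ b ⌋) ≡ true        ≈⟨ ∧-≡-true ⟩
  (a ∈R A × (A b ∧ ⌊ select σ a ≟ᵛ select σ b ⌋) ≡ true)  ≈⟨ ⇔-id _ ×-cong ∧-≡-true ⟩
  (a ∈R A × b ∈R A × ⌊ select σ a ≟ᵛ select σ b ⌋ ≡ true) ≈⟨ ⇔-id _ ×-cong (⇔-id _ ×-cong ⌊⌋-≡-true _) ⟩
  (a ∈R A × b ∈R A × select σ a ≡ select σ b)            ∎
  where
  open ⇔-Reasoning
  unfolded : kernel A σ (a ++ b) ≡ A a ∧ (A b ∧ ⌊ select σ a ≟ᵛ select σ b ⌋)
  unfolded = cong₂ _∧_ (cong A (select-↑ˡ a b))
                       (cong₂ _∧_ (cong A (select-↑ʳ a b))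
                                  (cong₂ (λ u v → ⌊ u ≟ᵛ v ⌋) (select-++ˡ σ a b) (select-++ʳ σ a b)))

kernel-congruence : ∀ {d} (Γ : Lang d) {A : Rel d n} → PPDef Γ A → (σ : Fin k → Fin n) →
                    Congruence Γ A (kernel A σ)
kernel-congruence Γ {A} PA σ =
  conjPP (reindexPP _ PA) (conjPP (reindexPP _ PA) (agreePP _ _)) ,
  (λ a b ab∈ → let a∈ , b∈ , _ = to (kernel-++ A σ a b) ab∈ in a∈ , b∈) ,
  (λ a a∈ → from (kernel-++ A σ a a) (a∈ , a∈ , refl)) ,
  (λ a b ab∈ → let a∈ , b∈ , σa≡σb = to (kernel-++ A σ a b) ab∈
               in from (kernel-++ A σ b a) (b∈ , a∈ , sym σa≡σb)) ,
  (λ a b c ab∈ bc∈ → let a∈ , _ , σa≡σb = to (kernel-++ A σ a b) ab∈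
                         _ , c∈ , σb≡σc = to (kernel-++ A σ b c) bc∈
                     in from (kernel-++ A σ a c) (a∈ , c∈ , trans σa≡σb σb≡σc))
  where open PP Γ

lookup-injective : {xs : List X} → Unique xs → ∀ i j → List.lookup xs i ≡ List.lookup xs j → i ≡ j
lookup-injective {xs = _ ∷ _} _          zero    zero    _ = refl
lookup-injective {xs = _ ∷ _} (x∉ ∷ _)   zero    (suc j) e = ⊥-elim (All.lookup x∉ (∈-lookup j) e)
lookup-injective {xs = _ ∷ _} (x∉ ∷ _)   (suc i) zero    e = ⊥-elim (All.lookup x∉ (∈-lookup i) (sym e))
lookup-injective {xs = _ ∷ _} (_ ∷ uniq) (suc i) (suc j) e = cong suc (lookup-injective uniq i j e)

-- Elements outside xs are sent to the position of x₀.
module Positions {X : Set} (_≟_ : DecidableEquality X) (xs : List X) {x₀ : X} (x₀∈xs : x₀ ∈ xs) where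
  open import Data.List.Membership.DecPropositional _≟_ using (_∈?_)

  position : X → Fin (List.length xs)
  position x with x ∈? xs
  ... | yes x∈xs = index x∈xs
  ... | no _     = index x₀∈xs

  lookup-position : ∀ {x} → x ∈ xs → List.lookup xs (position x) ≡ x
  lookup-position {x} x∈xs with x ∈? xs
  ... | yes x∈xs′ = sym (lookup-index x∈xs′)
  ... | no x∉xs   = ⊥-elim (x∉xs x∈xs)

  position-lookup : Unique xs → ∀ j → position (List.lookup xs j) ≡ j
  position-lookup uniq j = lookup-injective uniq _ j (lookup-position (∈-lookup j))

  position-injective : ∀ {x y} → x ∈ xs → y ∈ xs → position x ≡ position y → x ≡ y
  position-injective {x} {y} x∈xs y∈xs e = begin
    x                           ≡⟨ lookup-position x∈xs ⟨
    List.lookup xs (position x) ≡⟨ cong (List.lookup xs) e ⟩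
    List.lookup xs (position y) ≡⟨ lookup-position y∈xs ⟩
    y                           ∎
    where open ≡-Reasoning

∈-allVecs : ∀ {d} (v : Vec (Fin d) m) → v ∈ allVecs d m
∈-allVecs []      = here refl
∈-allVecs (i ∷ v) = ∈-concat⁺′ (∈-map⁺ (_∷ v) (∈-tabulate⁺ i)) (∈-map⁺ _ (∈-allVecs v))

-- Classes are indexed by the projections of the elements of A; the witness a₀ ∈ A only serves to
-- make the class map total (for empty A there are no classes).
module KernelClasses {d : ℕ} (A : Rel d n) (σ : Fin k → Fin n) {a₀ : Vec (Fin d) n} (a₀∈A : a₀ ∈R A) where

  image : List (Vec (Fin d) k)
  image = deduplicate _≟ᵛ_ (map (select σ) (filter (λ a → A a Bool.≟ true) (allVecs d n)))

  ∈-image⇔ : ∀ {x} → x ∈ image ⇔ ∃ λ a → a ∈R A × select σ a ≡ x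
  ∈-image⇔ = mk⇔
    (λ x∈ → let a , _ , x≡σa , a∈A = ∈-map∘filter⁻ (select σ) (λ a → A a Bool.≟ true) {xs = allVecs d n}
                                       (∈-deduplicate⁻ _≟ᵛ_ _ x∈)
            in a , a∈A , sym x≡σa)
    (λ (a , a∈A , σa≡x) → ∈-deduplicate⁺ _≟ᵛ_
       (∈-map∘filter⁺ (select σ) (λ a → A a Bool.≟ true) (a , ∈-allVecs a , sym σa≡x , a∈A)))

  open Positions _≟ᵛ_ image (from ∈-image⇔ (a₀ , a₀∈A , refl)) public

  classOf : Vec (Fin d) n → Fin (List.length image)
  classOf a = position (select σ a)

  classOf⇔ : ∀ {a x} → a ∈R A → x ∈ image → classOf a ≡ position x ⇔ select σ a ≡ x
  classOf⇔ a∈A x∈ = mk⇔ (position-injective (from ∈-image⇔ (_ , a∈A , refl)) x∈) (cong position)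

  classOf-enumerates : ClassEnumeration A (kernel A σ) (List.length image) classOf
  classOf-enumerates = representative , sameClass
    where
    representative : ∀ j → ∃ λ a → a ∈R A × classOf a ≡ j
    representative j with a , a∈A , σa≡ ← to ∈-image⇔ (∈-lookup j) =
      a , a∈A , trans (cong position σa≡) (position-lookup (deduplicate-! _≟ᵛ_ _) j)
    sameClass : ∀ a b → a ∈R A → b ∈R A → (a ++ b) ∈R kernel A σ ⇔ classOf a ≡ classOf b
    sameClass a b a∈A b∈A = mk⇔
      (λ ab∈ → cong position (proj₂ (proj₂ (to (kernel-++ A σ a b) ab∈))))
      (λ same → from (kernel-++ A σ a b) (a∈A , b∈A , to (classOf⇔ a∈A (from ∈-image⇔ (b , b∈A , refl))) same))

module _ {d r ν₁ ν₂ : ℕ} {A : Rel d r} where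

  classCell⇔ : (c₁ : Vec (Fin d) r → Fin ν₁) (c₂ : Vec (Fin d) r → Fin ν₂) (j : Fin ν₁) (k : Fin ν₂)
               (a : Vec (Fin d) r) →
               (A a ∧ (⌊ c₁ a Fin.≟ j ⌋ ∧ ⌊ c₂ a Fin.≟ k ⌋) ≡ true) ⇔ (a ∈R A × c₁ a ≡ j × c₂ a ≡ k)
  classCell⇔ c₁ c₂ j k a =
    (⇔-id _ ×-cong ((⌊⌋-≡-true (c₁ a Fin.≟ j) ×-cong ⌊⌋-≡-true (c₂ a Fin.≟ k)) ⇔-∘ ∧-≡-true)) ⇔-∘ ∧-≡-true

  classMatrix≡count : {c₁ : Vec (Fin d) r → Fin ν₁} {c₂ : Vec (Fin d) r → Fin ν₂} {j : Fin ν₁} {k : Fin ν₂}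
                      (Q : Vec (Fin d) r → Bool) → (∀ a → (a ∈R A × c₁ a ≡ j × c₂ a ≡ k) ⇔ Q a ≡ true) →
                      classMatrix r A c₁ c₂ j k ≡ count r Q
  classMatrix≡count {c₁} {c₂} {j} {k} Q inCell = count-cong (λ a → ⇔→≡ (inCell a ⇔-∘ classCell⇔ c₁ c₂ j k a))

module _ {d ν₁ ν₂ : ℕ} where

  classMatrix-nullary : (A : Rel d 0) (c₁ : Vec (Fin d) 0 → Fin ν₁) (c₂ : Vec (Fin d) 0 → Fin ν₂) →
                        RankOneBlock (classMatrix 0 A c₁ c₂)
  classMatrix-nullary A c₁ c₂ =
    RankOneBlock-reindex (λ (_ _ : ⊤) → classMatrix 0 A c₁ c₂ (c₁ []) (c₂ [])) (classMatrix 0 A c₁ c₂)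
      (λ _ → tt) (λ _ → tt) (_≡ c₁ []) (_≡ c₂ []) onlyCell (λ { _ _ refl refl → refl }) (RankOneBlock-const _)
    where
    onlyCell : ∀ j k → 0 < classMatrix 0 A c₁ c₂ j k → j ≡ c₁ [] × k ≡ c₂ []
    onlyCell j k pos
      with [] , inCell ← count-witness {P = λ a → A a ∧ (⌊ c₁ a Fin.≟ j ⌋ ∧ ⌊ c₂ a Fin.≟ k ⌋)} pos
      with _ , c₁≡j , c₂≡k ← to (classCell⇔ {A = A} c₁ c₂ j k []) inCell = sym c₁≡j , sym c₂≡k

module _ {d r ν : ℕ} (Γ : Lang d) {A : Rel d r} {ρ : Rel d (r + r)} {c : Vec (Fin d) r → Fin ν}
         (C : Congruence Γ A ρ) (E : ClassEnumeration A ρ ν c) where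

  representative : Fin ν → Vec (Fin d) r
  representative j = proj₁ (proj₁ E j)

  related-representative⇔ : ∀ j a → (representative j ++ a) ∈R ρ ⇔ (a ∈R A × c a ≡ j)
  related-representative⇔ j a = mk⇔
    (λ related → let a∈A = proj₂ (proj₁ (proj₂ C) _ a related)
                 in a∈A , trans (sym (to (sameClass a∈A) related)) rep∈j)
    (λ (a∈A , a∈j) → from (sameClass a∈A) (trans rep∈j (sym a∈j)))
    where
    rep∈j : c (representative j) ≡ j
    rep∈j = proj₂ (proj₂ (proj₁ E j))
    sameClass : a ∈R A → (representative j ++ a) ∈R ρ ⇔ c (representative j) ≡ c a
    sameClass a∈A = proj₂ E (representative j) a (proj₁ (proj₂ (proj₁ E j))) a∈A

-- Strongly balanced ⇒ congruence singular

module _ {r : ℕ} where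

  xz yz : Fin (r + r) → Fin ((r + r) + r)
  xz = ((_↑ˡ r) ∘ (_↑ˡ r)) ⊕ (((r + r) ↑ʳ_) ∘ id)
  yz = ((_↑ˡ r) ∘ (r ↑ʳ_)) ⊕ (((r + r) ↑ʳ_) ∘ id)

  linked : ∀ {d} → Rel d (r + r) → Rel d (r + r) → Rel d ((r + r) + r)
  linked ρ₁ ρ₂ w = ρ₁ (select xz w) ∧ ρ₂ (select yz w)

  linked-++ : ∀ {d} (ρ₁ ρ₂ : Rel d (r + r)) (x y z : Vec (Fin d) r) →
              linked ρ₁ ρ₂ ((x ++ y) ++ z) ≡ ρ₁ (x ++ z) ∧ ρ₂ (y ++ z)
  linked-++ ρ₁ ρ₂ x y z = cong₂ _∧_
    (cong ρ₁ (trans (select-⊕-++ (_↑ˡ r) id (x ++ y) z) (cong₂ _++_ (select-↑ˡ x y) (select-id z))))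
    (cong ρ₂ (trans (select-⊕-++ (r ↑ʳ_) id (x ++ y) z) (cong₂ _++_ (select-↑ʳ x y) (select-id z))))

stronglyBalanced⇒congruenceSingular : ∀ {d} (Γ : Lang d) → StronglyBalanced Γ → CongruenceSingular Γ
stronglyBalanced⇒congruenceSingular Γ _ zero A _ _ _ _ _ _ c₁ _ c₂ _ _ = classMatrix-nullary A c₁ c₂
stronglyBalanced⇒congruenceSingular {d} Γ balanced (suc r) A _ ρ₁ ρ₂ C₁ C₂ ν₁ c₁ ν₂ c₂ E₁ E₂ =
  RankOneBlock-reindex (balMatrix R (suc r) (suc r) short) (classMatrix (suc r) A c₁ c₂) x y (λ _ → ⊤) (λ _ → ⊤)
    (λ _ _ _ → tt , tt) (λ j k _ _ → cell j k)
    (balanced _ R (+-mono-≤ (+-mono-≤ 1≤ 1≤) 1≤) PR (suc r) (suc r) 1≤ 1≤ short)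
  where
  open PP Γ
  R : Rel d ((suc r + suc r) + suc r)
  R = linked {r = suc r} ρ₁ ρ₂
  PR : PPDef Γ R
  PR = conjPP (reindexPP (xz {r = suc r}) (proj₁ C₁)) (reindexPP (yz {r = suc r}) (proj₁ C₂))
  1≤ : 1 ≤ suc r
  1≤ = s≤s z≤n
  short : suc r + suc r < (suc r + suc r) + suc r
  short = m<m+n _ 1≤
  x : Fin ν₁ → Vec (Fin d) (suc r)
  x = representative Γ C₁ E₁
  y : Fin ν₂ → Vec (Fin d) (suc r)
  y = representative Γ C₂ E₂
  cell : ∀ j k → classMatrix (suc r) A c₁ c₂ j k ≡ balMatrix R (suc r) (suc r) short (x j) (y k)
  cell j k = begin
    classMatrix (suc r) A c₁ c₂ j k                     ≡⟨ classMatrix≡count _ inBoth ⟩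
    count (suc r) (λ z → ρ₁ (x j ++ z) ∧ ρ₂ (y k ++ z)) ≡⟨ count-cong (linked-++ ρ₁ ρ₂ (x j) (y k)) ⟨
    count (suc r) (λ z → R ((x j ++ y k) ++ z))         ≡⟨ balMatrix-++ R short (x j) (y k) ⟨
    balMatrix R (suc r) (suc r) short (x j) (y k)       ∎
    where
    open ≡-Reasoning
    inBoth : ∀ a → (a ∈R A × c₁ a ≡ j × c₂ a ≡ k) ⇔ (ρ₁ (x j ++ a) ∧ ρ₂ (y k ++ a) ≡ true)
    inBoth a = mk⇔
      (λ (a∈A , a∈j , a∈k) → from ∧-≡-true (from (related₁ j a) (a∈A , a∈j) , from (related₂ k a) (a∈A , a∈k)))
      (λ both → let a∈A , a∈j = to (related₁ j a) (proj₁ (to ∧-≡-true both))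
                in a∈A , a∈j , proj₂ (to (related₂ k a) (proj₂ (to ∧-≡-true both))))
      where
      related₁ : ∀ j a → (x j ++ a) ∈R ρ₁ ⇔ (a ∈R A × c₁ a ≡ j)
      related₁ = related-representative⇔ Γ C₁ E₁
      related₂ : ∀ k a → (y k ++ a) ∈R ρ₂ ⇔ (a ∈R A × c₂ a ≡ k)
      related₂ = related-representative⇔ Γ C₂ E₂

-- Congruence singular ⇒ strongly balanced

module _ {d : ℕ} (Γ : Lang d) (singular : CongruenceSingular Γ) {n : ℕ} {R : Rel d n} (PR : PPDef Γ R)
         (k ℓ : ℕ) (short : k + ℓ < n) where
  open PP Γ

  private
    m′ : ℕ
    m′ = n ∸ (k + ℓ)

    -- R with its arity read as (k + ℓ) + m′, so that balMatrix R is literally a count over R′.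
    R′ : Rel d ((k + ℓ) + m′)
    R′ w = R (cast (m+[n∸m]≡n (<⇒≤ short)) w)

    σx : Fin k → Fin ((k + ℓ) + m′)
    σx = (_↑ˡ m′) ∘ (_↑ˡ ℓ)

    σy : Fin ℓ → Fin ((k + ℓ) + m′)
    σy = (_↑ˡ m′) ∘ (k ↑ʳ_)

    select-σx : (x : Vec (Fin d) k) (y : Vec (Fin d) ℓ) (z : Vec (Fin d) m′) → select σx ((x ++ y) ++ z) ≡ x
    select-σx x y z = trans (select-++ˡ (_↑ˡ ℓ) (x ++ y) z) (select-↑ˡ x y)

    select-σy : (x : Vec (Fin d) k) (y : Vec (Fin d) ℓ) (z : Vec (Fin d) m′) → select σy ((x ++ y) ++ z) ≡ y
    select-σy x y z = trans (select-++ˡ (k ↑ʳ_) (x ++ y) z) (select-↑ʳ x y)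

    select-σxy⇔ : (a : Vec (Fin d) ((k + ℓ) + m′)) (x : Vec (Fin d) k) (y : Vec (Fin d) ℓ) →
                  (select σx a ≡ x × select σy a ≡ y) ⇔ select (_↑ˡ m′) a ≡ x ++ y
    select-σxy⇔ a x y = select-halves⇔ (select (_↑ˡ m′) a) x y ⇔-∘
      mk⇔ (Product.map (trans (sym (select-∘ (_↑ˡ m′) (_↑ˡ ℓ) a))) (trans (sym (select-∘ (_↑ˡ m′) (k ↑ʳ_) a))))
          (Product.map (trans (select-∘ (_↑ˡ m′) (_↑ˡ ℓ) a)) (trans (select-∘ (_↑ˡ m′) (k ↑ʳ_) a)))

    PR′ : PPDef Γ R′
    PR′ = castPP (m+[n∸m]≡n (<⇒≤ short)) PR

    inhabited⇒balMatrix-rankOne : ∀ {a₀} → a₀ ∈R R′ → RankOneBlock (balMatrix R k ℓ short)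
    inhabited⇒balMatrix-rankOne a₀∈R′ =
      RankOneBlock-reindex (classMatrix _ R′ X.classOf Y.classOf) (balMatrix R k ℓ short)
        X.position Y.position (_∈ X.image) (_∈ Y.image) support cell
        (singular _ R′ PR′ (kernel R′ σx) (kernel R′ σy)
                  (kernel-congruence Γ PR′ σx) (kernel-congruence Γ PR′ σy)
                  _ X.classOf _ Y.classOf X.classOf-enumerates Y.classOf-enumerates)
      where
      module X = KernelClasses R′ σx a₀∈R′
      module Y = KernelClasses R′ σy a₀∈R′
      support : ∀ x y → 0 < balMatrix R k ℓ short x y → x ∈ X.image × y ∈ Y.image
      support x y pos with z , xyz∈R′ ← count-witness {P = λ z → R′ ((x ++ y) ++ z)} pos =
        from X.∈-image⇔ (_ , xyz∈R′ , select-σx x y z) , from Y.∈-image⇔ (_ , xyz∈R′ , select-σy x y z)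
      cell : ∀ x y → x ∈ X.image → y ∈ Y.image →
             balMatrix R k ℓ short x y ≡ classMatrix _ R′ X.classOf Y.classOf (X.position x) (Y.position y)
      cell x y x∈ y∈ = sym (begin
        classMatrix _ R′ X.classOf Y.classOf (X.position x) (Y.position y) ≡⟨ classMatrix≡count Q inCell ⟩
        count _ Q                                                          ≡⟨ count-++ (x ++ y) Q forced ⟩
        count m′ (λ z → Q ((x ++ y) ++ z))                                  ≡⟨ count-cong prefixMatches ⟩
        count m′ (λ z → R′ ((x ++ y) ++ z))                                 ∎)
        where
        open ≡-Reasoning
        Q : Rel d ((k + ℓ) + m′)
        Q a = R′ a ∧ ⌊ select (_↑ˡ m′) a ≟ᵛ x ++ y ⌋
        classes⇔prefix : ∀ {a} → a ∈R R′ →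
                         (X.classOf a ≡ X.position x × Y.classOf a ≡ Y.position y) ⇔ select (_↑ˡ m′) a ≡ x ++ y
        classes⇔prefix {a} a∈ = select-σxy⇔ a x y ⇔-∘ (X.classOf⇔ a∈ x∈ ×-cong Y.classOf⇔ a∈ y∈)
        inCell : ∀ a → (a ∈R R′ × X.classOf a ≡ X.position x × Y.classOf a ≡ Y.position y) ⇔ Q a ≡ true
        inCell a = mk⇔
          (λ (a∈ , classes) → from ∧-≡-true (a∈ , from (⌊⌋-≡-true _) (to (classes⇔prefix a∈) classes)))
          (λ Qa → let a∈ , prefix = to (∧-≡-true {R′ a}) Qa
                  in a∈ , from (classes⇔prefix a∈) (to (⌊⌋-≡-true _) prefix))
        forced : ∀ u z → Q (u ++ z) ≡ true → u ≡ x ++ y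
        forced u z Quz =
          trans (sym (select-↑ˡ u z)) (to (⌊⌋-≡-true _) (proj₂ (to (∧-≡-true {R′ (u ++ z)}) Quz)))
        prefixMatches : ∀ z → Q ((x ++ y) ++ z) ≡ R′ ((x ++ y) ++ z)
        prefixMatches z =
          trans (cong (R′ ((x ++ y) ++ z) ∧_) (from (⌊⌋-≡-true _) (select-↑ˡ (x ++ y) z))) (∧-identityʳ _)

  balMatrix-rankOne : RankOneBlock (balMatrix R k ℓ short)
  balMatrix-rankOne = RankOneBlock-fromPositive _ λ x y pos →
    inhabited⇒balMatrix-rankOne (proj₂ (count-witness {P = λ z → R′ ((x ++ y) ++ z)} pos))

congruenceSingular⇒stronglyBalanced : ∀ {d} (Γ : Lang d) → CongruenceSingular Γ → StronglyBalanced Γ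
congruenceSingular⇒stronglyBalanced Γ singular _ _ _ PR k ℓ _ _ short =
  balMatrix-rankOne Γ singular PR k ℓ short

lemma7p5 : ∀ (d : ℕ) (Γ : Lang d) → CongruenceSingular Γ ⇔ StronglyBalanced Γ
lemma7p5 d Γ = mk⇔ (congruenceSingular⇒stronglyBalanced Γ) (stronglyBalanced⇒congruenceSingular Γ)
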